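{- Let $D$ be a comparability digraph. Then no implication class of $D$ contains a circuit. In particular, $I\neq I^{ -1}$ for every implication class $I$ of $D$.
   Context: A digraph $D=(V,A)$ is finite, without loops or multiple arcs; write $uv\in A$ for an arc. A comparability digraph is a digraph admitting a linear ordering $\prec$ of $V$ such that for all $x\prec y\prec z$: $xy,yz\in A$ implies $xz\in A$, and $zy,yx\in A$ implies $zx\in A$. Let $Z_D=\{(x,y): xy\in A\text{ or }yx\in A\}$. For $(x,y),(x',y')\in Z_D$ write $(x,y)\Gamma(x',y')$ if one of the following holds: (i) $x=x'$ and $y=y'$; (ii) $x=x'$, $y\ne y'$, and either ($yx,x'y'\in A$ and $yy'\notin A$) or ($y'x',xy\in A$ and $y'y\notin A$); (iii) $y=y'$, $x\ne x'$, and either ($xy,y'x'\in A$ and $xx'\notin A$) or ($x'y',yx\in A$ and $x'x\notin A$). The equivalence classes of the transitive closure $\Gamma^*$ of $\Gamma$ on $Z_D$ are the implication classes of $D$. For $I\subseteq Z_D$, $I^{ -1}=\{(y,x):(x,y)\in I\}$. A circuit of length $k$ is a set of pairs $(x_1,x_2),\dots,(x_{k-1},x_k),(x_k,x_1)$; a set of pairs contains it if all its pairs belong to the set. -}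

module Defs where

open import Level using (0ℓ)
open import Data.Nat using (ℕ)
open import Data.Fin using (Fin)
open import Data.Product using (_×_; _,_; Σ)
open import Data.Sum using (_⊎_)
open import Data.List using (List; []; _∷_)
open import Relation.Nullary using (¬_)
open import Relation.Binary using (Rel; Decidable; IsStrictTotalOrder)
open import Relation.Binary.PropositionalEquality using (_≡_)
open import Relation.Binary.Construct.Closure.Transitive using (TransClosure)

-- A finite digraph on the vertex set Fin n, without loops.
-- (Multiple arcs are excluded automatically: arcs form a relation.)
record Digraph (n : ℕ) : Set₁ where
  field
    Arc     : Fin n → Fin n → Set
    arc?    : Decidable Arc
    noLoops : ∀ x → ¬ Arc x x

Pair : ℕ → Set
Pair n = Fin n × Fin n

module _ {n : ℕ} (D : Digraph n) where
  open Digraph D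

  IsComparability : Set₁
  IsComparability =
    Σ (Rel (Fin n) 0ℓ) λ _≺_ →
      IsStrictTotalOrder _≡_ _≺_ ×
      (∀ x y z → x ≺ y → y ≺ z →
         (Arc x y → Arc y z → Arc x z) × (Arc z y → Arc y x → Arc z x))

  Z : Pair n → Set
  Z (x , y) = Arc x y ⊎ Arc y x

  Γ₀ : Pair n → Pair n → Set
  Γ₀ (x , y) (x' , y') =
      (x ≡ x' × y ≡ y')
    ⊎ (x ≡ x' × ¬ (y ≡ y') ×
        ((Arc y x × Arc x' y' × ¬ Arc y y') ⊎ (Arc y' x' × Arc x y × ¬ Arc y' y)))
    ⊎ (y ≡ y' × ¬ (x ≡ x') ×
        ((Arc x y × Arc y' x' × ¬ Arc x x') ⊎ (Arc x' y' × Arc y x × ¬ Arc x' x)))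

  Γ : Rel (Pair n) 0ℓ
  Γ p q = Z p × Z q × Γ₀ p q

  Γ* : Rel (Pair n) 0ℓ
  Γ* = TransClosure Γ

  ImplClass : Pair n → Pair n → Set
  ImplClass p q = Γ* p q

  PathIn : (Pair n → Set) → Fin n → List (Fin n) → Fin n → Set
  PathIn I x []       z = I (x , z)
  PathIn I x (y ∷ ys) z = I (x , y) × PathIn I y ys z

  -- I contains the circuit (x₁,x₂),…,(x_{k-1},x_k),(x_k,x₁), k ≥ 2,
  -- where x₁ = x and x₂ … x_k = y ∷ ys
  ContainsCircuit : (Pair n → Set) → Set
  ContainsCircuit I =
    Σ (Fin n) λ x → Σ (Fin n) λ y → Σ (List (Fin n)) λ ys → PathIn I x (y ∷ ys) x

  Inv : (Pair n → Set) → Pair n → Set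
  Inv I (x , y) = I (y , x)

  SameSet : (Pair n → Set) → (Pair n → Set) → Set
  SameSet I J = ∀ q → (I q → J q) × (J q → I q)

-- Fix a comparability ordering ≺ of D. Each of the rules (ii) and (iii) defining Γ
-- preserves whether a pair is ascending (x ≺ y): otherwise three vertices in
-- monotone order would violate transitivity of D along ≺. Hence the implication
-- class of an ascending pair consists of ascending pairs, and that of a descending
-- pair of descending ones (use the reversed ordering). A circuit cannot be
-- ascending throughout, and (x , y) ∈ I forces (y , x) ∉ I.
module Submission where

open import Defs
open import Level using (0ℓ)
open import Data.Nat using (ℕ)
open import Data.Fin using (Fin)
open import Data.Product using (_×_; _,_; proj₁; proj₂; swap)
open import Data.Sum using (inj₁; inj₂)
open import Data.List using ([]; _∷_)
open import Data.Empty using (⊥-elim)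
open import Function using (flip; _∘′_)
open import Relation.Nullary using (¬_)
open import Relation.Binary using (Rel; IsStrictTotalOrder; tri<; tri≈; tri>)
open import Relation.Binary.PropositionalEquality using (_≡_; refl)
open import Relation.Binary.Construct.Closure.Transitive using ([_]; _∷_)
import Relation.Binary.Construct.Flip.EqAndOrd as Flip

module _ {n : ℕ} (D : Digraph n) where
  open Digraph D

  ArcTransitiveAlong : Rel (Fin n) 0ℓ → Set
  ArcTransitiveAlong _≺_ = ∀ x y z → x ≺ y → y ≺ z →
    (Arc x y → Arc y z → Arc x z) × (Arc z y → Arc y x → Arc z x)

  flip-arcTransitiveAlong : ∀ {_≺_} → ArcTransitiveAlong _≺_ → ArcTransitiveAlong (flip _≺_)
  flip-arcTransitiveAlong trans x y z y≺x z≺y = swap (trans z y x z≺y y≺x)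

  Z-irreflexive : ∀ {x} → ¬ Z D (x , x)
  Z-irreflexive {x} (inj₁ xx) = noLoops x xx
  Z-irreflexive {x} (inj₂ xx) = noLoops x xx

  ImplClass-refl : ∀ {p} → Z D p → ImplClass D p p
  ImplClass-refl zp = [ zp , zp , inj₁ (refl , refl) ]

  module Ascent {_≺_ : Rel (Fin n) 0ℓ} (sto : IsStrictTotalOrder _≡_ _≺_)
                (arcTrans : ArcTransitiveAlong _≺_) where
    open IsStrictTotalOrder sto using (compare; irrefl; trans)

    Ascending : Pair n → Set
    Ascending (x , y) = x ≺ y

    Γ-ascending : ∀ {p q} → Γ D p q → Ascending p → Ascending q
    Γ-ascending (_ , _ , inj₁ (refl , refl)) x≺y = x≺y
    Γ-ascending {x , y} {_ , y'} (_ , zq , inj₂ (inj₁ (refl , _ , arcs))) x≺y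
      with compare x y'
    ... | tri< x≺y' _ _ = x≺y'
    ... | tri≈ _ refl _ = ⊥-elim (Z-irreflexive zq)
    ... | tri> _ _ y'≺x with arcs
    ...   | inj₁ (yx , xy' , ¬yy') = ⊥-elim (¬yy' (proj₂ (arcTrans y' x y y'≺x x≺y) yx xy'))
    ...   | inj₂ (y'x , xy , ¬y'y) = ⊥-elim (¬y'y (proj₁ (arcTrans y' x y y'≺x x≺y) y'x xy))
    Γ-ascending {x , y} {x' , _} (_ , zq , inj₂ (inj₂ (refl , _ , arcs))) x≺y
      with compare x' y
    ... | tri< x'≺y _ _ = x'≺y
    ... | tri≈ _ refl _ = ⊥-elim (Z-irreflexive zq)
    ... | tri> _ _ y≺x' with arcs
    ...   | inj₁ (xy , yx' , ¬xx') = ⊥-elim (¬xx' (proj₁ (arcTrans x y x' x≺y y≺x') xy yx'))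
    ...   | inj₂ (x'y , yx , ¬x'x) = ⊥-elim (¬x'x (proj₂ (arcTrans x y x' x≺y y≺x') x'y yx))

    Γ*-ascending : ∀ {p q} → Γ* D p q → Ascending p → Ascending q
    Γ*-ascending [ pq ]      = Γ-ascending pq
    Γ*-ascending (pq ∷ qr) = Γ*-ascending qr ∘′ Γ-ascending pq

    ascending-increasing : ∀ {I} → (∀ {q} → I q → Ascending q) →
      ∀ {x z} ys → PathIn D I x ys z → x ≺ z
    ascending-increasing I⊆↑ []       xz          = I⊆↑ xz
    ascending-increasing I⊆↑ (y ∷ ys) (xy , y⋯z) = trans (I⊆↑ xy) (ascending-increasing I⊆↑ ys y⋯z)

    ascending-noCircuit : ∀ {I} → (∀ {q} → I q → Ascending q) → ¬ ContainsCircuit D I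
    ascending-noCircuit I⊆↑ (x , y , ys , x⋯x) = irrefl refl (ascending-increasing I⊆↑ (y ∷ ys) x⋯x)

    ascending-≉Inv : ∀ {I p} → (∀ {q} → I q → Ascending q) → I p → ¬ SameSet D I (Inv D I)
    ascending-≉Inv {p = x , y} I⊆↑ Ixy I≈I⁻¹ =
      irrefl refl (trans (I⊆↑ Ixy) (I⊆↑ (proj₁ (I≈I⁻¹ (x , y)) Ixy)))

    ascendingClass-noCircuit-≉Inv : ∀ {p} → Z D p → Ascending p →
      ¬ ContainsCircuit D (ImplClass D p) × ¬ SameSet D (ImplClass D p) (Inv D (ImplClass D p))
    ascendingClass-noCircuit-≉Inv zp ↑p =
      ascending-noCircuit class⊆↑ , ascending-≉Inv class⊆↑ (ImplClass-refl zp)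
      where
      class⊆↑ : ∀ {q} → ImplClass D _ q → Ascending q
      class⊆↑ pq = Γ*-ascending pq ↑p

mainTheorem12 : ∀ {n : ℕ} (D : Digraph n) → IsComparability D →
    ∀ p → Z D p →
      ¬ ContainsCircuit D (ImplClass D p) × ¬ SameSet D (ImplClass D p) (Inv D (ImplClass D p))
mainTheorem12 D (_ , sto , arcTrans) (x , y) zp with IsStrictTotalOrder.compare sto x y
... | tri< x≺y _ _ = Ascent.ascendingClass-noCircuit-≉Inv D sto arcTrans zp x≺y
... | tri≈ _ refl _ = ⊥-elim (Z-irreflexive D zp)
... | tri> _ _ y≺x = Ascent.ascendingClass-noCircuit-≉Inv D
                       (Flip.isStrictTotalOrder sto) (flip-arcTransitiveAlong D arcTrans) zp y≺x
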